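{- Let $G=(V,E)$ be a directed graph, let $T_1,\dots,T_k\subseteq V$ be terminal sets, let $F\subseteq E$ be a set of undeletable edges, and let $p\ge 0$ be an integer. Let $e\in E\setminus F$ be an edge whose tail is reachable from $T_1$ by a directed path all of whose edges lie in $F$ (possibly the empty path), and whose head lies outside $T_1$. Suppose that the minimum size of a $(T_1, T_2\cup\dots\cup T_k)$-separator with undeletable edges $F$ equals the minimum size of a $(T_1, T_2\cup\dots\cup T_k)$-separator with undeletable edges $F\cup\{e\}$, and that this common size is at most $p$. Then the minimum size of a linear cut for $\langle T_1,\dots,T_k\rangle$ in $G$ with undeletable edges $F$ equals the minimum size of a linear cut for $\langle T_1,\dots,T_k\rangle$ in $G$ with undeletable edges $F\cup\{e\}$.
   Context: For $X,Y\subseteq V$ and $F\subseteq E$, an $(X,Y)$-separator with undeletable edges $F$ is a set $S\subseteq E\setminus F$ such that every directed path from a vertex of $X$ to a vertex of $Y$ uses an edge of $S$. A linear cut for the tuple $\langle T_1,\dots,T_k\rangle$ with undeletable edges $F$ is a set $S\subseteq E\setminus F$ such that in $(V,E\setminus S)$ there is no directed path from a vertex of $T_i$ to a vertex of $T_j$ whenever $i<j$. -}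

module Defs where

open import Data.Nat using (ℕ; suc; _≤_)
open import Data.Fin using (Fin; zero; suc; _<_)
open import Data.Fin.Subset using (Subset; _∈_; _∉_; ∣_∣)
open import Data.List using (List; []; _∷_)
open import Data.List.Relation.Unary.Any using (Any)
open import Data.Product using (Σ; ∃; _×_)
open import Relation.Binary.PropositionalEquality using (_≡_)

record Digraph : Set where
  field
    n    : ℕ
    m    : ℕ
    tail : Fin m → Fin n
    head : Fin m → Fin n
open Digraph public

data Walk (G : Digraph) : Fin (n G) → Fin (n G) → List (Fin (m G)) → Set where
  [] : ∀ {u} → Walk G u u []
  _∷_ : ∀ {v es} (e : Fin (m G)) → Walk G (head G e) v es → Walk G (tail G e) v (e ∷ es)

Avoids : ∀ {m} → Subset m → Subset m → Set
Avoids {m} S F = ∀ (e : Fin m) → e ∈ S → e ∉ F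

IsSeparator : (G : Digraph) → (Fin (n G) → Set) → (Fin (n G) → Set)
            → Subset (m G) → Subset (m G) → Set
IsSeparator G X Y F S =
  Avoids S F ×
  (∀ x y es → X x → Y y → Walk G x y es → Any (_∈ S) es)

IsLinearCut : (G : Digraph) {k : ℕ} → (Fin k → Subset (n G))
            → Subset (m G) → Subset (m G) → Set
IsLinearCut G {k} T F S =
  Avoids S F ×
  (∀ (i j : Fin k) → i < j → ∀ x y es → x ∈ T i → y ∈ T j →
     Walk G x y es → Any (_∈ S) es)

IsMinSize : ∀ {m} → (Subset m → Set) → ℕ → Set
IsMinSize {m} P s = (Σ (Subset m) λ S → P S × ∣ S ∣ ≡ s) × (∀ S → P S → s ≤ ∣ S ∣)

First : ∀ {N k} → (Fin (suc k) → Subset N) → Fin N → Set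
First T v = v ∈ T zero

Rest : ∀ {N k} → (Fin (suc k) → Subset N) → Fin N → Set
Rest {k = k} T v = ∃ λ (j : Fin k) → v ∈ T (suc j)

-- Let S be a linear cut avoiding F and C a minimum (T₁, T₂ ∪ … ∪ Tₖ)-separator avoiding
-- F ∪ {e}, and let A and B be the vertex sets reachable from T₁ in G − S and G − C.
-- Neither meets T₂ ∪ … ∪ Tₖ, and B contains both ends of e (the F-path to tail e survives
-- in G − C, and e ∉ C). Replacing the edges of S with tail in A ∪ B by δ⁺(A ∪ B) gives a
-- linear cut S' that avoids e, and by submodularity of the directed cut function
-- |S'| + |δ⁺(A ∩ B)| ≤ |S| + |C|. Since δ⁺(A ∩ B) is an F-separator, it is no smaller
-- than C, so |S'| ≤ |S|.
module Submission where

open import Defs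
open import Data.Nat using (ℕ; suc; _≤_)
open import Data.Fin using (Fin; zero; suc)
open import Data.Fin.Subset using (Subset; _∈_; _∉_; _∪_; ⁅_⁆)
open import Data.List using (List)
open import Data.List.Relation.Unary.All using (All)
open import Data.Product using (Σ; _×_)
open import Function.Bundles using (_⇔_)

open import Data.Nat using (zero; _+_; s≤s; z≤n)
open import Data.Nat.Properties
  using (+-suc; +-mono-≤; +-monoʳ-≤; ≤-<-trans; +-cancelʳ-≤; <⇒≱; ≤-trans; ≤-antisym; ≤-reflexive; m≤m+n; module ≤-Reasoning)
open import Data.Fin using (_<_; _≟_)
open import Data.Fin.Properties using (any?)
open import Data.Fin.Subset using (_∩_; _⊆_; ∣_∣; inside; outside)
open import Data.Fin.Subset.Properties
  using (_∈?_; _⊂?_; ∣p∣≤n; p⊂q⇒∣p∣<∣q∣; p⊆q⇒∣p∣≤∣q∣; p⊆p∪q;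
         x∈p∪q⁺; x∈p∪q⁻; x∈p∩q⁺; x∈p∩q⁻; x∈⁅x⁆; x∈⁅y⁆⇒x≡y)
open import Data.Vec using ([]; _∷_; tabulate)
open import Data.Vec.Properties using (lookup∘tabulate; lookup⇒[]=; []=⇒lookup)
open import Data.List using ([]; _∷_; _++_)
open import Data.List.Relation.Unary.Any as Any using (Any; here; there)
open import Data.List.Relation.Unary.All using ([]; _∷_)
import Data.List.Relation.Unary.All as All
open import Data.List.Relation.Unary.All.Properties using (++⁺; All¬⇒¬Any)
open import Data.Product using (_,_; ∃; proj₁; proj₂)
open import Data.Sum using (_⊎_; inj₁; inj₂)
open import Function using (_∘_)
open import Function.Bundles using (mk⇔)
open import Relation.Nullary using (Dec; ¬_; yes; no; does; contradiction; ¬?; _×-dec_; _⊎-dec_)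
open import Relation.Nullary.Decidable using (dec-true)
open import Relation.Unary using (Pred; Decidable)
open import Relation.Binary.PropositionalEquality using (_≡_; refl; sym; trans; cong; subst; module ≡-Reasoning)

module _ {N : ℕ} where

  _∉?_ : (x : Fin N) (p : Subset N) → Dec (x ∉ p)
  x ∉? p = ¬? (x ∈? p)

  subsetOf : ∀ {ℓ} {P : Pred (Fin N) ℓ} → Decidable P → Subset N
  subsetOf P? = tabulate (does ∘ P?)

  module _ {ℓ} {P : Pred (Fin N) ℓ} (P? : Decidable P) where

    ∈subsetOf⁺ : ∀ {x} → P x → x ∈ subsetOf P?
    ∈subsetOf⁺ {x} px = lookup⇒[]= x _ (trans (lookup∘tabulate (does ∘ P?) x) (dec-true (P? x) px))

    ∈subsetOf⁻ : ∀ {x} → x ∈ subsetOf P? → P x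
    ∈subsetOf⁻ {x} x∈ with P? x | trans (sym (lookup∘tabulate (does ∘ P?) x)) ([]=⇒lookup x∈)
    ... | yes px | _ = px
    ... | no _   | ()

∣p∪q∣+∣p∩q∣≡∣p∣+∣q∣ : ∀ {N} (p q : Subset N) → ∣ p ∪ q ∣ + ∣ p ∩ q ∣ ≡ ∣ p ∣ + ∣ q ∣
∣p∪q∣+∣p∩q∣≡∣p∣+∣q∣ []            []            = refl
∣p∪q∣+∣p∩q∣≡∣p∣+∣q∣ (outside ∷ p) (outside ∷ q) = ∣p∪q∣+∣p∩q∣≡∣p∣+∣q∣ p q
∣p∪q∣+∣p∩q∣≡∣p∣+∣q∣ (inside  ∷ p) (outside ∷ q) = cong suc (∣p∪q∣+∣p∩q∣≡∣p∣+∣q∣ p q)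
∣p∪q∣+∣p∩q∣≡∣p∣+∣q∣ (outside ∷ p) (inside  ∷ q) =
  trans (cong suc (∣p∪q∣+∣p∩q∣≡∣p∣+∣q∣ p q)) (sym (+-suc (∣ p ∣) (∣ q ∣)))
∣p∪q∣+∣p∩q∣≡∣p∣+∣q∣ (inside  ∷ p) (inside  ∷ q) = cong suc (begin
  ∣ p ∪ q ∣ + suc ∣ p ∩ q ∣ ≡⟨ +-suc (∣ p ∪ q ∣) (∣ p ∩ q ∣) ⟩
  suc (∣ p ∪ q ∣ + ∣ p ∩ q ∣) ≡⟨ cong suc (∣p∪q∣+∣p∩q∣≡∣p∣+∣q∣ p q) ⟩
  suc (∣ p ∣ + ∣ q ∣)       ≡⟨ sym (+-suc (∣ p ∣) (∣ q ∣)) ⟩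
  ∣ p ∣ + suc ∣ q ∣         ∎)
  where open ≡-Reasoning

∣p∣+∣q∣≤∣r∣+∣s∣ : ∀ {N} {p q r s : Subset N} → p ∪ q ⊆ r ∪ s → p ∩ q ⊆ r ∩ s →
                 ∣ p ∣ + ∣ q ∣ ≤ ∣ r ∣ + ∣ s ∣
∣p∣+∣q∣≤∣r∣+∣s∣ {p = p} {q} {r} {s} ∪⊆ ∩⊆ = begin
  ∣ p ∣ + ∣ q ∣             ≡⟨ sym (∣p∪q∣+∣p∩q∣≡∣p∣+∣q∣ p q) ⟩
  ∣ p ∪ q ∣ + ∣ p ∩ q ∣     ≤⟨ +-mono-≤ (p⊆q⇒∣p∣≤∣q∣ ∪⊆) (p⊆q⇒∣p∣≤∣q∣ ∩⊆) ⟩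
  ∣ r ∪ s ∣ + ∣ r ∩ s ∣     ≡⟨ ∣p∪q∣+∣p∩q∣≡∣p∣+∣q∣ r s ⟩
  ∣ r ∣ + ∣ s ∣             ∎
  where open ≤-Reasoning

Avoids-antimono : ∀ {M} {S F F′ : Subset M} → F ⊆ F′ → Avoids S F′ → Avoids S F
Avoids-antimono F⊆F′ S-avoids f f∈S f∈F = S-avoids f f∈S (F⊆F′ f∈F)

IsMinSize-⇔ : ∀ {M} {P Q : Subset M → Set} {c : ℕ} → (∀ {S} → Q S → P S) →
              (∀ {S} → P S → Σ (Subset M) λ S′ → Q S′ × ∣ S′ ∣ ≤ ∣ S ∣) →
              IsMinSize P c ⇔ IsMinSize Q c
IsMinSize-⇔ {P = P} {Q} {c} Q⇒P improve = mk⇔ to from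
  where
  to : IsMinSize P c → IsMinSize Q c
  to ((S , PS , ∣S∣≡c) , c≤) with improve PS
  ... | S′ , QS′ , ∣S′∣≤∣S∣ =
    (S′ , QS′ , ≤-antisym (≤-trans ∣S′∣≤∣S∣ (≤-reflexive ∣S∣≡c)) (c≤ S′ (Q⇒P QS′))) ,
    λ S″ QS″ → c≤ S″ (Q⇒P QS″)

  from : IsMinSize Q c → IsMinSize P c
  from ((S , QS , ∣S∣≡c) , c≤) =
    (S , Q⇒P QS , ∣S∣≡c) ,
    λ S″ PS″ → let (S‴ , QS‴ , ∣S‴∣≤∣S″∣) = improve PS″ in ≤-trans (c≤ S‴ QS‴) ∣S‴∣≤∣S″∣

module _ (G : Digraph) where

  Leaves : Subset (n G) → Fin (m G) → Set
  Leaves P f = tail G f ∈ P × head G f ∉ P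

  leaves? : ∀ P → Decidable (Leaves P)
  leaves? P f = tail G f ∈? P ×-dec head G f ∉? P

  leaving : Subset (n G) → Subset (m G)
  leaving P = subsetOf (leaves? P)

  ∈leaving⁺ : ∀ {P f} → Leaves P f → f ∈ leaving P
  ∈leaving⁺ {P} = ∈subsetOf⁺ (leaves? P)

  ∈leaving⁻ : ∀ {P f} → f ∈ leaving P → Leaves P f
  ∈leaving⁻ {P} = ∈subsetOf⁻ (leaves? P)

  walk-leaves : (P : Subset (n G)) → ∀ {x y es} → x ∈ P → y ∉ P → Walk G x y es →
                Any (_∈ leaving P) es
  walk-leaves P x∈P y∉P []      = contradiction x∈P y∉P
  walk-leaves P x∈P y∉P (f ∷ w) with head G f ∈? P
  ... | yes h∈P = there (walk-leaves P h∈P y∉P w)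
  ... | no  h∉P = here (∈leaving⁺ (x∈P , h∉P))

  Walk-snoc : ∀ {x es} (f : Fin (m G)) → Walk G x (tail G f) es → Walk G x (head G f) (es ++ f ∷ [])
  Walk-snoc f []      = f ∷ []
  Walk-snoc f (g ∷ w) = g ∷ Walk-snoc f w

  InPushCut : Subset (n G) → Subset (m G) → Fin (m G) → Set
  InPushCut U S f = (tail G f ∉ U × f ∈ S) ⊎ Leaves U f

  inPushCut? : ∀ U S → Decidable (InPushCut U S)
  inPushCut? U S f = (tail G f ∉? U ×-dec f ∈? S) ⊎-dec leaves? U f

  pushCut : Subset (n G) → Subset (m G) → Subset (m G)
  pushCut U S = subsetOf (inPushCut? U S)

  ∈pushCut⁺ : ∀ {U S f} → InPushCut U S f → f ∈ pushCut U S
  ∈pushCut⁺ {U} {S} = ∈subsetOf⁺ (inPushCut? U S)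

  ∈pushCut⁻ : ∀ {U S f} → f ∈ pushCut U S → InPushCut U S f
  ∈pushCut⁻ {U} {S} = ∈subsetOf⁻ (inPushCut? U S)

  leaving⊆pushCut : ∀ U S → leaving U ⊆ pushCut U S
  leaving⊆pushCut U S f∈ = ∈pushCut⁺ (inj₂ (∈leaving⁻ f∈))

  pushCut-hits : ∀ U S {x y es} → y ∉ U → Walk G x y es → Any (_∈ S) es → Any (_∈ pushCut U S) es
  pushCut-hits U S y∉U (f ∷ w) (there hit) = there (pushCut-hits U S y∉U w hit)
  pushCut-hits U S y∉U (f ∷ w) (here f∈S) with tail G f ∈? U
  ... | no  t∉U = here (∈pushCut⁺ (inj₁ (t∉U , f∈S)))
  ... | yes t∈U = Any.map (leaving⊆pushCut U S) (walk-leaves U t∈U y∉U (f ∷ w))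

  module Uncrossing {A B : Subset (n G)} {S C : Subset (m G)}
                    (leaving-A⊆S : leaving A ⊆ S) (leaving-B⊆C : leaving B ⊆ C) where

    leaving-∪⊆ : leaving (A ∪ B) ⊆ S ∪ C
    leaving-∪⊆ {f} f∈ with ∈leaving⁻ f∈
    ... | t∈A∪B , h∉A∪B with x∈p∪q⁻ A B t∈A∪B
    ... | inj₁ t∈A = x∈p∪q⁺ (inj₁ (leaving-A⊆S (∈leaving⁺ (t∈A , h∉A∪B ∘ x∈p∪q⁺ ∘ inj₁))))
    ... | inj₂ t∈B = x∈p∪q⁺ (inj₂ (leaving-B⊆C (∈leaving⁺ (t∈B , h∉A∪B ∘ x∈p∪q⁺ ∘ inj₂))))

    pushCut⊆ : pushCut (A ∪ B) S ⊆ S ∪ C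
    pushCut⊆ f∈ with ∈pushCut⁻ f∈
    ... | inj₁ (_ , f∈S) = x∈p∪q⁺ (inj₁ f∈S)
    ... | inj₂ leaves    = leaving-∪⊆ (∈leaving⁺ leaves)

    leaving-∩⊆ : leaving (A ∩ B) ⊆ S ∪ C
    leaving-∩⊆ {f} f∈ with ∈leaving⁻ f∈
    ... | t∈A∩B , h∉A∩B with x∈p∩q⁻ A B t∈A∩B | head G f ∈? A
    ... | t∈A , t∈B | no h∉A  = x∈p∪q⁺ (inj₁ (leaving-A⊆S (∈leaving⁺ (t∈A , h∉A))))
    ... | t∈A , t∈B | yes h∈A =
      x∈p∪q⁺ (inj₂ (leaving-B⊆C (∈leaving⁺ (t∈B , λ h∈B → h∉A∩B (x∈p∩q⁺ (h∈A , h∈B))))))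

    pushCut∩leaving⊆ : pushCut (A ∪ B) S ∩ leaving (A ∩ B) ⊆ S ∩ C
    pushCut∩leaving⊆ {f} f∈ with x∈p∩q⁻ (pushCut (A ∪ B) S) (leaving (A ∩ B)) f∈
    ... | f∈S′ , f∈δ with ∈leaving⁻ f∈δ
    ... | t∈A∩B , _ with x∈p∩q⁻ A B t∈A∩B | ∈pushCut⁻ f∈S′
    ... | t∈A , _   | inj₁ (t∉A∪B , _) = contradiction (x∈p∪q⁺ (inj₁ t∈A)) t∉A∪B
    ... | t∈A , t∈B | inj₂ (_ , h∉A∪B) =
      x∈p∩q⁺ ( leaving-A⊆S (∈leaving⁺ (t∈A , h∉A∪B ∘ x∈p∪q⁺ ∘ inj₁))
             , leaving-B⊆C (∈leaving⁺ (t∈B , h∉A∪B ∘ x∈p∪q⁺ ∘ inj₂)))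

    ∣pushCut∣+∣leaving∩∣≤∣S∣+∣C∣ : ∣ pushCut (A ∪ B) S ∣ + ∣ leaving (A ∩ B) ∣ ≤ ∣ S ∣ + ∣ C ∣
    ∣pushCut∣+∣leaving∩∣≤∣S∣+∣C∣ = ∣p∣+∣q∣≤∣r∣+∣s∣ ∪⊆ pushCut∩leaving⊆
      where
      ∪⊆ : pushCut (A ∪ B) S ∪ leaving (A ∩ B) ⊆ S ∪ C
      ∪⊆ f∈ with x∈p∪q⁻ _ _ f∈
      ... | inj₁ f∈S′ = pushCut⊆ f∈S′
      ... | inj₂ f∈δ  = leaving-∩⊆ f∈δ

  module Reachability (X : Subset (m G)) where

    Closed : Subset (n G) → Set
    Closed P = ∀ f → tail G f ∈ P → f ∉ X → head G f ∈ P

    Reachable : Subset (n G) → Fin (n G) → Set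
    Reachable R v = Σ (Fin (n G)) λ x → Σ (List (Fin (m G))) λ es →
                    x ∈ R × Walk G x v es × All (_∉ X) es

    closed-walk : ∀ {P x y es} → Closed P → x ∈ P → Walk G x y es → All (_∉ X) es → y ∈ P
    closed-walk closed x∈P []      []           = x∈P
    closed-walk closed x∈P (f ∷ w) (f∉X ∷ f∉Xs) = closed-walk closed (closed f x∈P f∉X) w f∉Xs

    closed⇒leaving⊆ : ∀ {P} → Closed P → leaving P ⊆ X
    closed⇒leaving⊆ closed {f} f∈ with ∈leaving⁻ f∈ | f ∈? X
    ... | _           | yes f∈X = f∈X
    ... | t∈P , h∉P   | no  f∉X = contradiction (closed f t∈P f∉X) h∉P

    unreachable : ∀ {R} {Y : Fin (n G) → Set} →
                  (∀ x y es → x ∈ R → Y y → Walk G x y es → Any (_∈ X) es) →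
                  ∀ {v} → Reachable R v → ¬ Y v
    unreachable separates (x , es , x∈R , w , avoids) Yv = All¬⇒¬Any avoids (separates x _ es x∈R Yv w)

    Step : Subset (n G) → Fin (n G) → Set
    Step P v = ∃ λ f → tail G f ∈ P × f ∉ X × head G f ≡ v

    step? : ∀ P → Decidable (Step P)
    step? P v = any? λ f → tail G f ∈? P ×-dec f ∉? X ×-dec head G f ≟ v

    expand : Subset (n G) → Subset (n G)
    expand P = P ∪ subsetOf (step? P)

    expand-reachable : ∀ {R P} → (∀ {v} → v ∈ P → Reachable R v) → ∀ {v} → v ∈ expand P → Reachable R v
    expand-reachable reach {v} v∈ with x∈p∪q⁻ _ _ v∈
    ... | inj₁ v∈P = reach v∈P
    ... | inj₂ v∈succ with ∈subsetOf⁻ (step? _) v∈succ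
    ... | f , t∈P , f∉X , refl with reach t∈P
    ... | x , es , x∈R , w , avoids = x , es ++ f ∷ [] , x∈R , Walk-snoc f w , ++⁺ avoids (f∉X ∷ [])

    record ReachableSet (R : Subset (n G)) : Set where
      field
        set       : Subset (n G)
        sources   : R ⊆ set
        closed    : Closed set
        reachable : ∀ {v} → v ∈ set → Reachable R v

    -- Every step of expand that is not stable adds a vertex, so n G steps suffice.
    reachableSet : (R : Subset (n G)) → ReachableSet R
    reachableSet R = iterate (n G) R (λ x∈R → x∈R) (λ {v} v∈R → v , [] , v∈R , [] , []) (m≤m+n (n G) (∣ R ∣))
      where
      iterate : (fuel : ℕ) (P : Subset (n G)) → R ⊆ P → (∀ {v} → v ∈ P → Reachable R v) →
                n G ≤ fuel + ∣ P ∣ → ReachableSet R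
      iterate fuel P R⊆P reach bound with P ⊂? expand P
      iterate zero       P R⊆P reach bound | yes P⊂P′ =
        contradiction (∣p∣≤n (expand P)) (<⇒≱ (≤-<-trans bound (p⊂q⇒∣p∣<∣q∣ P⊂P′)))
      iterate (suc fuel) P R⊆P reach bound | yes P⊂P′ =
        iterate fuel (expand P) (p⊆p∪q _ ∘ R⊆P) (expand-reachable reach)
          (≤-trans bound (≤-trans (≤-reflexive (sym (+-suc fuel (∣ P ∣)))) (+-monoʳ-≤ fuel (p⊂q⇒∣p∣<∣q∣ P⊂P′))))
      iterate fuel P R⊆P reach bound | no P⊄P′ = record
        { set = P ; sources = R⊆P ; closed = closed ; reachable = reach }
        where
        stable : ∀ {v} → v ∈ expand P → v ∈ P
        stable {v} v∈ with v ∈? P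
        ... | yes v∈P = v∈P
        ... | no  v∉P = contradiction ((λ {x} → p⊆p∪q _) , v , v∈ , v∉P) P⊄P′

        closed : Closed P
        closed f t∈P f∉X = stable (x∈p∪q⁺ (inj₂ (∈subsetOf⁺ (step? P) (f , t∈P , f∉X , refl))))

module _ (G : Digraph) {k : ℕ} (T : Fin (suc k) → Subset (n G)) (F : Subset (m G)) (e : Fin (m G))
         (F-path : Σ (Fin (n G)) λ t → Σ (List (Fin (m G))) λ es →
                   t ∈ T zero × Walk G t (tail G e) es × All (_∈ F) es)
         {C : Subset (m G)} (C-separates : IsSeparator G (First T) (Rest T) (F ∪ ⁅ e ⁆) C)
         (C-minimal : ∀ S → IsSeparator G (First T) (Rest T) F S → ∣ C ∣ ≤ ∣ S ∣)
         where

  module C-side where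
    open Reachability G C public
    open ReachableSet (reachableSet (T zero)) public

    e-inside : tail G e ∈ set × head G e ∈ set
    e-inside = t∈B , closed e t∈B (λ e∈C → proj₁ C-separates e e∈C (x∈p∪q⁺ (inj₂ (x∈⁅x⁆ e))))
      where
      t∈B : tail G e ∈ set
      t∈B = let (t , es , t∈T₁ , w , inF) = F-path in
            closed-walk closed (sources t∈T₁) w
              (All.map (λ f∈F f∈C → proj₁ C-separates _ f∈C (p⊆p∪q ⁅ e ⁆ f∈F)) inF)

    misses-later : ∀ j {y} → y ∈ T (suc j) → y ∉ set
    misses-later j y∈Tⱼ y∈B = unreachable (proj₂ C-separates) (reachable y∈B) (j , y∈Tⱼ)

  linearCut-push : ∀ {S} → IsLinearCut G T F S →
                   Σ (Subset (m G)) λ S′ → IsLinearCut G T (F ∪ ⁅ e ⁆) S′ × ∣ S′ ∣ ≤ ∣ S ∣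
  linearCut-push {S} (S-avoids , S-cuts) = S′ , (S′-avoids , S′-cuts) , ∣S′∣≤∣S∣
    where
    open Reachability G S
    open ReachableSet (reachableSet (T zero)) renaming (set to A)
    B = C-side.set
    open Uncrossing G (closed⇒leaving⊆ closed) (C-side.closed⇒leaving⊆ C-side.closed)

    S′ = pushCut G (A ∪ B) S
    D  = leaving G (A ∩ B)

    misses-later : ∀ j {y} → y ∈ T (suc j) → y ∉ A ∪ B
    misses-later j y∈Tⱼ y∈A∪B with x∈p∪q⁻ A B y∈A∪B
    ... | inj₁ y∈A = unreachable (S-cuts zero (suc j) (s≤s z≤n)) (reachable y∈A) y∈Tⱼ
    ... | inj₂ y∈B = C-side.misses-later j y∈Tⱼ y∈B

    S∪C-avoids : Avoids (S ∪ C) F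
    S∪C-avoids f f∈S∪C with x∈p∪q⁻ S C f∈S∪C
    ... | inj₁ f∈S = S-avoids f f∈S
    ... | inj₂ f∈C = proj₁ C-separates f f∈C ∘ p⊆p∪q ⁅ e ⁆

    D-separates : IsSeparator G (First T) (Rest T) F D
    D-separates =
      (λ f f∈D → S∪C-avoids f (leaving-∩⊆ f∈D)) ,
      λ x y es x∈T₁ (j , y∈Tⱼ) w →
        walk-leaves G (A ∩ B) (x∈p∩q⁺ (sources x∈T₁ , C-side.sources x∈T₁))
          (λ y∈A∩B → misses-later j y∈Tⱼ (x∈p∪q⁺ (inj₁ (proj₁ (x∈p∩q⁻ A B y∈A∩B))))) w

    S′-avoids : Avoids S′ (F ∪ ⁅ e ⁆)
    S′-avoids f f∈S′ f∈F∪e with x∈p∪q⁻ F ⁅ e ⁆ f∈F∪e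
    ... | inj₁ f∈F = S∪C-avoids f (pushCut⊆ f∈S′) f∈F
    ... | inj₂ f∈⁅e⁆ with x∈⁅y⁆⇒x≡y e f∈⁅e⁆
    ... | refl with ∈pushCut⁻ G f∈S′
    ... | inj₁ (t∉A∪B , _) = t∉A∪B (x∈p∪q⁺ (inj₂ (proj₁ C-side.e-inside)))
    ... | inj₂ (_ , h∉A∪B) = h∉A∪B (x∈p∪q⁺ (inj₂ (proj₂ C-side.e-inside)))

    S′-cuts : ∀ i j → i < j → ∀ x y es → x ∈ T i → y ∈ T j → Walk G x y es → Any (_∈ S′) es
    S′-cuts i (suc j) i<j x y es x∈Tᵢ y∈Tⱼ w =
      pushCut-hits G (A ∪ B) S (misses-later j y∈Tⱼ) w (S-cuts i (suc j) i<j x y es x∈Tᵢ y∈Tⱼ w)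

    ∣S′∣≤∣S∣ : ∣ S′ ∣ ≤ ∣ S ∣
    ∣S′∣≤∣S∣ = +-cancelʳ-≤ (∣ C ∣) (∣ S′ ∣) (∣ S ∣) (begin
      ∣ S′ ∣ + ∣ C ∣ ≤⟨ +-monoʳ-≤ (∣ S′ ∣) (C-minimal D D-separates) ⟩
      ∣ S′ ∣ + ∣ D ∣ ≤⟨ ∣pushCut∣+∣leaving∩∣≤∣S∣+∣C∣ ⟩
      ∣ S ∣ + ∣ C ∣  ∎)
      where open ≤-Reasoning

theorem2 : (G : Digraph) (k : ℕ) (T : Fin (suc k) → Subset (n G))
    (F : Subset (m G)) (p : ℕ) (e : Fin (m G)) →
    e ∉ F →
    (Σ (Fin (n G)) λ t → Σ (List (Fin (m G))) λ es →
       t ∈ T zero × Walk G t (tail G e) es × All (_∈ F) es) →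
    head G e ∉ T zero →
    (s : ℕ) →
    IsMinSize (IsSeparator G (First T) (Rest T) F) s →
    IsMinSize (IsSeparator G (First T) (Rest T) (F ∪ ⁅ e ⁆)) s →
    s ≤ p →
    (c : ℕ) →
    IsMinSize (IsLinearCut G T F) c ⇔ IsMinSize (IsLinearCut G T (F ∪ ⁅ e ⁆)) c
theorem2 G k T F p e _ F-path _ s (_ , s≤F-separators) ((C , C-separates , ∣C∣≡s) , _) _ c =
  IsMinSize-⇔ (λ (avoids , cuts) → Avoids-antimono (p⊆p∪q ⁅ e ⁆) avoids , cuts)
              (linearCut-push G T F e F-path C-separates C-minimal)
  where
  C-minimal : ∀ S → IsSeparator G (First T) (Rest T) F S → ∣ C ∣ ≤ ∣ S ∣
  C-minimal S S-separates = subst (_≤ ∣ S ∣) (sym ∣C∣≡s) (s≤F-separators S S-separates)
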